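{- Let $k\ge 0$ be an integer and $n=48k+14$. Define $c_3(r)\in\mathbb{Z}_n$ for $0\le r\le n-1$ as follows (all arithmetic modulo $n$): for $0\le i\le 12k+3$, $c_3(2i)=6k+2+i(12k+5)$; for $0\le i\le 12k+2$, $c_3(2i+1)=24k+8+i(12k+5)$ (this defines $c_3(r)$ for $0\le r\le 24k+6$); and for $0\le r\le 24k+6$, $c_3(n-1-r)=n-1-c_3(r)$. Let ${\cal L}_3=[l_3(r,j)]$ be the $n\times n$ array with $l_3(r,j)\equiv c_3(r)+j \pmod n$ for $0\le r,j\le n-1$. Then ${\cal L}_3$ is a Latin square of order $n$.
   Context: A Latin square of order $n$ is an $n\times n$ array in which each row and each column contains each of the symbols $0,1,\dots,n-1$ exactly once. -}

module Defs where

open import Data.Nat using (ℕ; zero; suc; _+_; _*_; _∸_; _≤?_; NonZero)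
open import Data.Nat.DivMod using (_%_; _/_; m%n<n)
open import Data.Fin using (Fin; toℕ; fromℕ<)
open import Data.Product using (Σ; _×_; _,_)
open import Relation.Binary.PropositionalEquality using (_≡_)
open import Relation.Nullary using (yes; no)

-- the order n = 48k+14 (written as a successor so that Fin / mod are easy)
order : ℕ → ℕ
order k = suc (48 * k + 13)

c3-half : ℕ → ℕ → ℕ
c3-half k r with r % 2
... | zero  = (6 * k + 2 + (r / 2) * (12 * k + 5)) % order k
... | suc _ = (24 * k + 8 + (r / 2) * (12 * k + 5)) % order k

c3ℕ : ℕ → ℕ → ℕ
c3ℕ k r with r ≤? 24 * k + 6
... | yes _ = c3-half k r
... | no  _ = (order k ∸ 1) ∸ c3-half k ((order k ∸ 1) ∸ r)

L3 : (k : ℕ) → Fin (order k) → Fin (order k) → Fin (order k)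
L3 k r j = fromℕ< (m%n<n (c3ℕ k (toℕ r) + toℕ j) (order k))

ExactlyOnce : {A : Set} → (A → Set) → Set
ExactlyOnce {A} P = Σ A (λ a → P a × ((b : A) → P b → b ≡ a))

IsLatinSquare : (n : ℕ) → (Fin n → Fin n → Fin n) → Set
IsLatinSquare n L =
  ((r : Fin n) (s : Fin n) → ExactlyOnce (λ j → L r j ≡ s)) ×
  ((j : Fin n) (s : Fin n) → ExactlyOnce (λ r → L r j ≡ s))

module Submission where

-- With n = 48k+14 and d = 12k+5, every c₃(r) is congruent mod n to 6k+2 + (t(r) − (24k+7))·d, where
-- t is a permutation of {0,…,n−1}: on the first half, t(2i) = 24k+7+i and t(2i+1) = 36k+11+i
-- interleave the two progressions, and since 2(6k+2) − d ≡ −1 the reflection c₃(n−1−r) = n−1−c₃(r)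
-- becomes t(n−1−r) = n−1−t(r). As d·(8k+3) ≡ 1 (mod n), c₃ is injective mod n, so the columns
-- of the cyclic array c₃(r) + j are injective; its rows are translates, and an injective
-- endomap of a finite set hits every symbol exactly once.

open import Defs
open import Data.Nat using (ℕ; zero; suc; _+_; _*_; _∸_; pred; _≤_; _<_; s≤s; s≤s⁻¹; NonZero; _≤?_)
open import Data.Nat.Properties
open import Data.Nat.DivMod
open import Data.Nat.Tactic.RingSolver using (solve-∀)
open import Data.Fin using (Fin; toℕ; fromℕ<; punchOut)
open import Data.Fin.Properties using (any?; punchOut-injective; injective⇒≤; toℕ-injective; toℕ-fromℕ<; toℕ<n)
  renaming (_≟_ to _≟ᶠ_)
open import Data.Product using (∃; _,_)
open import Relation.Nullary using (yes; no; contradiction)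
open import Relation.Binary.PropositionalEquality
open import Function.Definitions using (Injective)

injective⇒hasPreimage : ∀ {n} {f : Fin n → Fin n} → Injective _≡_ _≡_ f → ∀ s → ∃ λ x → f x ≡ s
injective⇒hasPreimage {suc _} {f} f-inj s with any? (λ x → f x ≟ᶠ s)
... | yes hit  = hit
... | no  miss = contradiction (injective⇒≤ punchOut∘f-injective) 1+n≰n
  where
  f≢s : ∀ x → s ≢ f x
  f≢s x s≡fx = miss (x , sym s≡fx)
  punchOut∘f-injective : Injective _≡_ _≡_ (λ x → punchOut (f≢s x))
  punchOut∘f-injective eq = f-inj (punchOut-injective (f≢s _) (f≢s _) eq)

injective⇒exactlyOnce : ∀ {n} {f : Fin n → Fin n} → Injective _≡_ _≡_ f → ∀ s → ExactlyOnce (λ x → f x ≡ s)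
injective⇒exactlyOnce f-inj s with injective⇒hasPreimage f-inj s
... | x , fx≡s = x , fx≡s , λ y fy≡s → f-inj (trans fy≡s (sym fx≡s))

module Modular (n : ℕ) .{{_ : NonZero n}} where

  infix 4 _≈_
  _≈_ : ℕ → ℕ → Set
  x ≈ y = x % n ≡ y % n

  %-≈ : ∀ x → x % n ≈ x
  %-≈ x = m%n%n≡m%n x n

  +-multiple : ∀ x t → x + t * n ≈ x
  +-multiple x t = [m+kn]%n≡m%n x t n

  +-congˡ : ∀ z {x y} → x ≈ y → z + x ≈ z + y
  +-congˡ z {x} {y} p =
    trans (%-distribˡ-+ z x n) (trans (cong (λ u → (z % n + u) % n) p) (sym (%-distribˡ-+ z y n)))

  +-congʳ : ∀ z {x y} → x ≈ y → x + z ≈ y + z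
  +-congʳ z {x} {y} p =
    trans (%-distribˡ-+ x z n) (trans (cong (λ u → (u + z % n) % n) p) (sym (%-distribˡ-+ y z n)))

  *-congˡ : ∀ z {x y} → x ≈ y → z * x ≈ z * y
  *-congˡ z {x} {y} p =
    trans (%-distribˡ-* z x n) (trans (cong (λ u → (z % n * u) % n) p) (sym (%-distribˡ-* z y n)))

  *-congʳ : ∀ z {x y} → x ≈ y → x * z ≈ y * z
  *-congʳ z {x} {y} p =
    trans (%-distribˡ-* x z n) (trans (cong (λ u → (u * (z % n)) % n) p) (sym (%-distribˡ-* y z n)))

  -- Subtracting z is adding z·(n − 1).
  +-cancelʳ : ∀ {x y} z → x + z ≈ y + z → x ≈ y
  +-cancelʳ {x} {y} z p = begin
    x % n                        ≡⟨ +-multiple x z ⟨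
    (x + z * n) % n              ≡⟨ cong (_% n) (shift x) ⟩
    (x + z + z * pred n) % n     ≡⟨ +-congʳ (z * pred n) p ⟩
    (y + z + z * pred n) % n     ≡⟨ cong (_% n) (shift y) ⟨
    (y + z * n) % n              ≡⟨ +-multiple y z ⟩
    y % n                        ∎
    where
    open ≡-Reasoning
    shift : ∀ w → w + z * n ≡ w + z + z * pred n
    shift w = begin
      w + z * n                  ≡⟨ cong (λ m → w + z * m) (suc-pred n) ⟨
      w + z * suc (pred n)       ≡⟨ cong (w +_) (*-suc z (pred n)) ⟩
      w + (z + z * pred n)       ≡⟨ +-assoc w z (z * pred n) ⟨
      w + z + z * pred n         ∎

  +-cancelˡ : ∀ {x y} z → z + x ≈ z + y → x ≈ y
  +-cancelˡ {x} {y} z p = +-cancelʳ z (trans (cong (_% n) (+-comm x z)) (trans p (cong (_% n) (+-comm z y))))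

  *-cancelʳ-invertible : ∀ {x y d e} → d * e ≈ 1 → x * d ≈ y * d → x ≈ y
  *-cancelʳ-invertible {x} {y} {d} {e} de≈1 p = begin
    x % n                        ≡⟨ cong (_% n) (*-identityʳ x) ⟨
    (x * 1) % n                  ≡⟨ *-congˡ x (sym de≈1) ⟩
    (x * (d * e)) % n            ≡⟨ cong (_% n) (*-assoc x d e) ⟨
    (x * d * e) % n              ≡⟨ *-congʳ e p ⟩
    (y * d * e) % n              ≡⟨ cong (_% n) (*-assoc y d e) ⟩
    (y * (d * e)) % n            ≡⟨ *-congˡ y de≈1 ⟩
    (y * 1) % n                  ≡⟨ cong (_% n) (*-identityʳ y) ⟩
    y % n                        ∎
    where open ≡-Reasoning

  ≈⇒≡ : ∀ {x y} → x < n → y < n → x ≈ y → x ≡ y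
  ≈⇒≡ {x} {y} x<n y<n x≈y = trans (sym (m<n⇒m%n≡m x<n)) (trans x≈y (m<n⇒m%n≡m y<n))

  cyclicArray : (ℕ → ℕ) → Fin n → Fin n → Fin n
  cyclicArray c r j = fromℕ< (m%n<n (c (toℕ r) + toℕ j) n)

  cyclicArray-≈ : ∀ c {r j r′ j′} → cyclicArray c r j ≡ cyclicArray c r′ j′ →
                  c (toℕ r) + toℕ j ≈ c (toℕ r′) + toℕ j′
  cyclicArray-≈ c {r} {j} {r′} {j′} eq = begin
    (c (toℕ r) + toℕ j) % n      ≡⟨ toℕ-fromℕ< (m%n<n (c (toℕ r) + toℕ j) n) ⟨
    toℕ (cyclicArray c r j)      ≡⟨ cong toℕ eq ⟩
    toℕ (cyclicArray c r′ j′)    ≡⟨ toℕ-fromℕ< (m%n<n (c (toℕ r′) + toℕ j′) n) ⟩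
    (c (toℕ r′) + toℕ j′) % n    ∎
    where open ≡-Reasoning

  cyclicArray-isLatinSquare : ∀ c → (∀ {r r′} → r < n → r′ < n → c r ≈ c r′ → r ≡ r′) →
                              IsLatinSquare n (cyclicArray c)
  cyclicArray-isLatinSquare c c-inj =
    (λ r → injective⇒exactlyOnce (row-injective r)) ,
    (λ j → injective⇒exactlyOnce (column-injective j))
    where
    row-injective : ∀ r → Injective _≡_ _≡_ (cyclicArray c r)
    row-injective r {j} {j′} eq =
      toℕ-injective (≈⇒≡ (toℕ<n j) (toℕ<n j′) (+-cancelˡ (c (toℕ r)) (cyclicArray-≈ c eq)))
    column-injective : ∀ j → Injective _≡_ _≡_ (λ r → cyclicArray c r j)
    column-injective j {r} {r′} eq =
      toℕ-injective (c-inj (toℕ<n r) (toℕ<n r′) (+-cancelʳ (toℕ j) (cyclicArray-≈ c eq)))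

halfIndex : ℕ → ℕ → ℕ
halfIndex h r = r % 2 * suc h + r / 2

module _ (h : ℕ) where

  private
    *2-cancel-≤ : ∀ {q} → q * 2 ≤ h * 2 → q ≤ h
    *2-cancel-≤ {q} = *-cancelʳ-≤ q h 2

    *2-cancel-< : ∀ {q} → suc (q * 2) ≤ h * 2 → q < h
    *2-cancel-< {q} = *-cancelʳ-< 2 q h

    h*2≡h+h : h * 2 ≡ h + h
    h*2≡h+h = trans (*-comm h 2) (cong (h +_) (+-identityʳ h))

    odd-index : ∀ q → 1 * suc h + q ≡ h + suc q
    odd-index q = trans (cong (_+ q) (*-identityˡ (suc h))) (sym (+-suc h q))

  interleave-≤ : ∀ p q → p < 2 → p + q * 2 ≤ h * 2 → p * suc h + q ≤ h * 2
  interleave-≤ zero       q _ le = ≤-trans (*2-cancel-≤ le) (m≤m*n h 2)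
  interleave-≤ (suc zero) q _ le = begin
    1 * suc h + q  ≡⟨ odd-index q ⟩
    h + suc q      ≤⟨ +-monoʳ-≤ h (*2-cancel-< le) ⟩
    h + h          ≡⟨ h*2≡h+h ⟨
    h * 2          ∎
    where open ≤-Reasoning
  interleave-≤ (suc (suc _)) _ (s≤s (s≤s ())) _

  interleave-injective : ∀ p q p′ q′ → p < 2 → p′ < 2 → p + q * 2 ≤ h * 2 → p′ + q′ * 2 ≤ h * 2 →
                         p * suc h + q ≡ p′ * suc h + q′ → p + q * 2 ≡ p′ + q′ * 2
  interleave-injective zero       q zero       q′ _ _ _  _  e = cong (_* 2) e
  interleave-injective (suc zero) q (suc zero) q′ _ _ _  _  e =
    cong (λ x → 1 + x * 2) (+-cancelˡ-≡ (1 * suc h) q q′ e)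
  interleave-injective zero       q (suc zero) q′ _ _ le _  e =
    contradiction (subst (_≤ h) (trans e (odd-index q′)) (*2-cancel-≤ le)) (m+1+n≰m h)
  interleave-injective (suc zero) q zero       q′ _ _ _  le e =
    contradiction (subst (_≤ h) (trans (sym e) (odd-index q)) (*2-cancel-≤ le)) (m+1+n≰m h)
  interleave-injective (suc (suc _)) _ _ _ (s≤s (s≤s ())) _ _ _ _
  interleave-injective _ _ (suc (suc _)) _ _ (s≤s (s≤s ())) _ _ _

  private
    halves : ∀ {r} → r ≤ h * 2 → r % 2 + r / 2 * 2 ≤ h * 2
    halves {r} = subst (_≤ h * 2) (m≡m%n+[m/n]*n r 2)

  halfIndex-≤ : ∀ {r} → r ≤ h * 2 → halfIndex h r ≤ h * 2
  halfIndex-≤ {r} le = interleave-≤ (r % 2) (r / 2) (m%n<n r 2) (halves le)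

  halfIndex-injective : ∀ {r r′} → r ≤ h * 2 → r′ ≤ h * 2 → halfIndex h r ≡ halfIndex h r′ → r ≡ r′
  halfIndex-injective {r} {r′} le le′ e = begin
    r                   ≡⟨ m≡m%n+[m/n]*n r 2 ⟩
    r % 2 + r / 2 * 2   ≡⟨ interleave-injective (r % 2) (r / 2) (r′ % 2) (r′ / 2)
                             (m%n<n r 2) (m%n<n r′ 2) (halves le) (halves le′) e ⟩
    r′ % 2 + r′ / 2 * 2 ≡⟨ m≡m%n+[m/n]*n r′ 2 ⟨
    r′                  ∎
    where open ≡-Reasoning

m∸n+o+n≡m+o : ∀ {m n} o → n ≤ m → m ∸ n + o + n ≡ m + o
m∸n+o+n≡m+o {m} {n} o n≤m = begin
  m ∸ n + o + n   ≡⟨ +-assoc (m ∸ n) o n ⟩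
  m ∸ n + (o + n) ≡⟨ cong (m ∸ n +_) (+-comm o n) ⟩
  m ∸ n + (n + o) ≡⟨ +-assoc (m ∸ n) n o ⟨
  m ∸ n + n + o   ≡⟨ cong (_+ o) (m∸n+n≡m n≤m) ⟩
  m + o           ∎
  where open ≡-Reasoning

a+a+[s+t]*d≡a+s*d+[a+t*d] : ∀ a d s t → a + a + (s + t) * d ≡ a + s * d + (a + t * d)
a+a+[s+t]*d≡a+s*d+[a+t*d] = solve-∀

private
  odd-row-shift : ∀ k q → 24 * k + 8 + q * (12 * k + 5) + (3 * k + 1) * suc (48 * k + 13)
                        ≡ 6 * k + 2 + (1 * suc (12 * k + 3) + q) * (12 * k + 5)
  odd-row-shift = solve-∀

  upper-shift : ∀ k i → 6 * k + 2 + i * (12 * k + 5) + suc (24 * k + 6) * (12 * k + 5)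
                      ≡ 6 * k + 2 + (suc (24 * k + 6) + i) * (12 * k + 5)
  upper-shift = solve-∀

  mirror-shift : ∀ k → 48 * k + 13 + suc (24 * k + 6) * (12 * k + 5)
               ≡ 6 * k + 2 + (6 * k + 2) + (24 * k + 6) * (12 * k + 5) + 1 * suc (48 * k + 13)
  mirror-shift = solve-∀

  inverse-shift : ∀ k → (12 * k + 5) * (8 * k + 3) ≡ 1 + (2 * k + 1) * suc (48 * k + 13)
  inverse-shift = solve-∀

  half≡h*2 : ∀ k → 24 * k + 6 ≡ (12 * k + 3) * 2
  half≡h*2 = solve-∀

  halves≡top : ∀ k → suc (24 * k + 6) + (24 * k + 6) ≡ 48 * k + 13
  halves≡top = solve-∀

module _ (k : ℕ) where
  open Modular (order k)

  c3-half-≈ : ∀ r → c3-half k r ≈ 6 * k + 2 + halfIndex (12 * k + 3) r * (12 * k + 5)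
  c3-half-≈ r with r % 2 | m%n<n r 2
  ... | zero     | _ = %-≈ (6 * k + 2 + r / 2 * (12 * k + 5))
  ... | suc zero | _ = begin
    c3-half-odd % order k % order k                 ≡⟨ %-≈ c3-half-odd ⟩
    c3-half-odd % order k                           ≡⟨ +-multiple c3-half-odd (3 * k + 1) ⟨
    (c3-half-odd + (3 * k + 1) * order k) % order k ≡⟨ cong (_% order k) (odd-row-shift k (r / 2)) ⟩
    (6 * k + 2 + (1 * suc (12 * k + 3) + r / 2) * (12 * k + 5)) % order k ∎
    where
    open ≡-Reasoning
    c3-half-odd : ℕ
    c3-half-odd = 24 * k + 8 + r / 2 * (12 * k + 5)
  ... | suc (suc _) | s≤s (s≤s ())

  c3-half-< : ∀ r → c3-half k r < order k
  c3-half-< r with r % 2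
  ... | zero  = m%n<n (6 * k + 2 + r / 2 * (12 * k + 5)) (order k)
  ... | suc _ = m%n<n (24 * k + 8 + r / 2 * (12 * k + 5)) (order k)

  mirror-≤ : ∀ {r} → 24 * k + 6 < r → 48 * k + 13 ∸ r ≤ 24 * k + 6
  mirror-≤ {r} H<r = begin
    48 * k + 13 ∸ r                                 ≤⟨ ∸-monoʳ-≤ (48 * k + 13) H<r ⟩
    48 * k + 13 ∸ suc (24 * k + 6)                  ≡⟨ cong (_∸ suc (24 * k + 6)) (halves≡top k) ⟨
    suc (24 * k + 6) + (24 * k + 6) ∸ suc (24 * k + 6) ≡⟨ m+n∸m≡n (suc (24 * k + 6)) (24 * k + 6) ⟩
    24 * k + 6                                      ∎
    where open ≤-Reasoning

  private
    ≤-half⇒≤-h*2 : ∀ {r} → r ≤ 24 * k + 6 → r ≤ (12 * k + 3) * 2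
    ≤-half⇒≤-h*2 {r} = subst (r ≤_) (half≡h*2 k)

  halfIndex-≤-half : ∀ {r} → r ≤ 24 * k + 6 → halfIndex (12 * k + 3) r ≤ 24 * k + 6
  halfIndex-≤-half {r} r≤H =
    subst (halfIndex (12 * k + 3) r ≤_) (sym (half≡h*2 k)) (halfIndex-≤ (12 * k + 3) (≤-half⇒≤-h*2 r≤H))

  progressionIndex : ℕ → ℕ
  progressionIndex r with r ≤? 24 * k + 6
  ... | yes _ = suc (24 * k + 6) + halfIndex (12 * k + 3) r
  ... | no  _ = 24 * k + 6 ∸ halfIndex (12 * k + 3) (48 * k + 13 ∸ r)

  -- c₃(r) ≡ 6k+2 + (t − (24k+7))·(12k+5) for t = progressionIndex r, with the shift moved to the left.
  c3-≈ : ∀ r → c3ℕ k r + suc (24 * k + 6) * (12 * k + 5) ≈ 6 * k + 2 + progressionIndex r * (12 * k + 5)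
  c3-≈ r with r ≤? 24 * k + 6
  ... | yes _ = trans (+-congʳ (suc (24 * k + 6) * (12 * k + 5)) {c3-half k r} {6 * k + 2 + P * (12 * k + 5)}
                               (c3-half-≈ r))
                      (cong (_% order k) (upper-shift k P))
    where
    P : ℕ
    P = halfIndex (12 * k + 3) r
  ... | no r≰H = +-cancelʳ {48 * k + 13 ∸ c3-half k ρ + N * d} {a + (24 * k + 6 ∸ P) * d} (c3-half k ρ) (begin
    (48 * k + 13 ∸ c3-half k ρ + N * d + c3-half k ρ) % n ≡⟨ cong (_% n) (m∸n+o+n≡m+o (N * d) (s≤s⁻¹ (c3-half-< ρ))) ⟩
    (48 * k + 13 + N * d) % n                         ≡⟨ cong (_% n) (mirror-shift k) ⟩
    (a + a + (24 * k + 6) * d + 1 * n) % n            ≡⟨ +-multiple (a + a + (24 * k + 6) * d) 1 ⟩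
    (a + a + (24 * k + 6) * d) % n                    ≡⟨ cong (λ t → (a + a + t * d) % n) (m∸n+n≡m P≤H) ⟨
    (a + a + (24 * k + 6 ∸ P + P) * d) % n             ≡⟨ cong (_% n) (a+a+[s+t]*d≡a+s*d+[a+t*d] a d (24 * k + 6 ∸ P) P) ⟩
    (a + (24 * k + 6 ∸ P) * d + (a + P * d)) % n       ≡⟨ +-congˡ (a + (24 * k + 6 ∸ P) * d) (c3-half-≈ ρ) ⟨
    (a + (24 * k + 6 ∸ P) * d + c3-half k ρ) % n       ∎)
    where
    open ≡-Reasoning
    n a d N ρ P : ℕ
    n = order k
    a = 6 * k + 2
    d = 12 * k + 5
    N = suc (24 * k + 6)
    ρ = 48 * k + 13 ∸ r
    P = halfIndex (12 * k + 3) ρ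
    P≤H : P ≤ 24 * k + 6
    P≤H = halfIndex-≤-half (mirror-≤ (≰⇒> r≰H))

  progressionIndex-< : ∀ r → progressionIndex r < order k
  progressionIndex-< r with r ≤? 24 * k + 6
  ... | yes r≤H = s≤s (begin
    suc (24 * k + 6) + halfIndex (12 * k + 3) r ≤⟨ +-monoʳ-≤ (suc (24 * k + 6)) (halfIndex-≤-half r≤H) ⟩
    suc (24 * k + 6) + (24 * k + 6)             ≡⟨ halves≡top k ⟩
    48 * k + 13                                 ∎)
    where open ≤-Reasoning
  ... | no _ = s≤s (begin
    24 * k + 6 ∸ halfIndex (12 * k + 3) (48 * k + 13 ∸ r) ≤⟨ m∸n≤m (24 * k + 6) (halfIndex (12 * k + 3) (48 * k + 13 ∸ r)) ⟩
    24 * k + 6                                            ≤⟨ m≤n+m (24 * k + 6) (suc (24 * k + 6)) ⟩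
    suc (24 * k + 6) + (24 * k + 6)                       ≡⟨ halves≡top k ⟩
    48 * k + 13                                           ∎)
    where open ≤-Reasoning

  private
    upper≢lower : ∀ i j → suc (24 * k + 6) + i ≢ 24 * k + 6 ∸ j
    upper≢lower i j e =
      1+n≰n (≤-trans (m≤m+n (suc (24 * k + 6)) i) (subst (_≤ 24 * k + 6) (sym e) (m∸n≤m (24 * k + 6) j)))

  progressionIndex-injective : ∀ {r r′} → r < order k → r′ < order k →
                               progressionIndex r ≡ progressionIndex r′ → r ≡ r′
  progressionIndex-injective {r} {r′} r<n r′<n e with r ≤? 24 * k + 6 | r′ ≤? 24 * k + 6
  ... | yes r≤H | yes r′≤H =
    halfIndex-injective (12 * k + 3) (≤-half⇒≤-h*2 r≤H) (≤-half⇒≤-h*2 r′≤H) (+-cancelˡ-≡ (suc (24 * k + 6)) _ _ e)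
  ... | yes _ | no _ =
    contradiction e (upper≢lower (halfIndex (12 * k + 3) r) (halfIndex (12 * k + 3) (48 * k + 13 ∸ r′)))
  ... | no _ | yes _ =
    contradiction (sym e) (upper≢lower (halfIndex (12 * k + 3) r′) (halfIndex (12 * k + 3) (48 * k + 13 ∸ r)))
  ... | no r≰H | no r′≰H = begin
    r                     ≡⟨ m∸[m∸n]≡n (s≤s⁻¹ r<n) ⟨
    48 * k + 13 ∸ ρ       ≡⟨ cong (48 * k + 13 ∸_) ρ≡ρ′ ⟩
    48 * k + 13 ∸ ρ′      ≡⟨ m∸[m∸n]≡n (s≤s⁻¹ r′<n) ⟩
    r′                    ∎
    where
    open ≡-Reasoning
    ρ ρ′ : ℕ
    ρ = 48 * k + 13 ∸ r
    ρ′ = 48 * k + 13 ∸ r′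
    ρ≤H : ρ ≤ 24 * k + 6
    ρ≤H = mirror-≤ (≰⇒> r≰H)
    ρ′≤H : ρ′ ≤ 24 * k + 6
    ρ′≤H = mirror-≤ (≰⇒> r′≰H)
    ρ≡ρ′ : ρ ≡ ρ′
    ρ≡ρ′ = halfIndex-injective (12 * k + 3) (≤-half⇒≤-h*2 ρ≤H) (≤-half⇒≤-h*2 ρ′≤H)
             (∸-cancelˡ-≡ (halfIndex-≤-half ρ≤H) (halfIndex-≤-half ρ′≤H) e)

  d-invertible : (12 * k + 5) * (8 * k + 3) ≈ 1
  d-invertible = trans (cong (_% order k) (inverse-shift k)) (+-multiple 1 (2 * k + 1))

  c3-injective : ∀ {r r′} → r < order k → r′ < order k → c3ℕ k r ≈ c3ℕ k r′ → r ≡ r′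
  c3-injective {r} {r′} r<n r′<n c≈c′ =
    progressionIndex-injective r<n r′<n (≈⇒≡ (progressionIndex-< r) (progressionIndex-< r′) index≈)
    where
    index≈ : progressionIndex r ≈ progressionIndex r′
    index≈ = *-cancelʳ-invertible {progressionIndex r} {progressionIndex r′} d-invertible
               (+-cancelˡ (6 * k + 2) (begin
      (6 * k + 2 + progressionIndex r * (12 * k + 5)) % order k   ≡⟨ c3-≈ r ⟨
      (c3ℕ k r + suc (24 * k + 6) * (12 * k + 5)) % order k       ≡⟨ +-congʳ _ {c3ℕ k r} {c3ℕ k r′} c≈c′ ⟩
      (c3ℕ k r′ + suc (24 * k + 6) * (12 * k + 5)) % order k      ≡⟨ c3-≈ r′ ⟩
      (6 * k + 2 + progressionIndex r′ * (12 * k + 5)) % order k  ∎))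
      where open ≡-Reasoning

lemma3 : (k : ℕ) → IsLatinSquare (order k) (L3 k)
lemma3 k = Modular.cyclicArray-isLatinSquare (order k) (c3ℕ k) (c3-injective k)
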